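{- For positive integers $a,b,c$, the triple $(a,b,c)$ is good if and only if the triple $(a,c,b)$ is good.
   Context: For positive integers $a,b,c$ with $n=a+b+c$, the permutation of the triple $(a,b,c)$ is the permutation of $[n]$ given in one-line notation by $n\ (n-1)\cdots(n-a+1)\ \ b\ (b-1)\cdots 1\ \ (b+c)\ (b+c-1)\cdots(b+1)$; i.e. $p_i=n+1-i$ for $1\le i\le a$, $p_i=a+b+1-i$ for $a+1\le i\le a+b$, and $p_i=n+b+1-i$ for $a+b+1\le i\le n$. The triple is good if this permutation, viewed as the bijection $i\mapsto p_i$ of $[n]$, is cyclic, i.e. consists of a single $n$-cycle. -}

module Defs where

open import Data.Nat using (ℕ; zero; suc; _+_; _∸_; _≤_; _≤ᵇ_)
open import Data.Bool using (if_then_else_)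
open import Data.Product using (∃)
open import Relation.Binary.PropositionalEquality using (_≡_)

iter : (ℕ → ℕ) → ℕ → ℕ → ℕ
iter f zero    x = x
iter f (suc k) x = f (iter f k x)

-- The permutation of the triple (a,b,c), as a map on positions i ∈ [n], n = a+b+c:
--   p_i = n+1-i        for 1 ≤ i ≤ a
--   p_i = a+b+1-i      for a+1 ≤ i ≤ a+b
--   p_i = n+b+1-i      for a+b+1 ≤ i ≤ n
-- (values outside [n] are irrelevant)
tripPerm : ℕ → ℕ → ℕ → ℕ → ℕ
tripPerm a b c i =
  if i ≤ᵇ a then suc (a + b + c) ∸ i
  else if i ≤ᵇ a + b then suc (a + b) ∸ i
  else suc (a + b + c + b) ∸ i

-- The permutation is cyclic (a single n-cycle on [n]): every element of [n]
-- is reached from every element of [n] by iterating the permutation.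
IsCyclic : (n : ℕ) → (ℕ → ℕ) → Set
IsCyclic n p = ∀ i j → 1 ≤ i → i ≤ n → 1 ≤ j → j ≤ n → ∃ λ k → iter p k i ≡ j

Good : ℕ → ℕ → ℕ → Set
Good a b c = IsCyclic (a + b + c) (tripPerm a b c)

module Submission where

-- The triple (a,c,b) is good iff (a,b,c) is: the two permutations are
-- conjugate-inverse to each other under the reversal  r(x) = N+1-x  of [N],
-- N = a+b+c.  Concretely, for every x ∈ [N],
--
--     p_{acb} (r (p_{abc} x)) = r x,                                  (★)
--
-- i.e. p_{acb} = r ∘ p_{abc}⁻¹ ∘ r on [N].  Since conjugating and inverting
-- a permutation both preserve having a single cycle, the claim follows.
--
-- Then (★) is checked block by block: [N] splits into the three
-- blocks [1,a], [a+1,a+b], [a+b+1,N] on which p_{abc} is a single reversal,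
-- and each block of (a,b,c) is sent by r ∘ p_{abc} onto a block of (a,c,b).

open import Defs
open import Data.Nat using (ℕ; zero; suc; _+_; _∸_; _≤_; _<_; _≤ᵇ_; _≤?_; s≤s; z≤n)
open import Data.Nat.Properties
  using (≤⇒≤ᵇ; ≤ᵇ⇒≤; <⇒≱; ≰⇒>; +-suc; +-cancelˡ-≤;
         m≤m+n; m<m+n; +-monoʳ-≤; m+n∸m≡n; m∸[m∸n]≡n; m≤n⇒∃[o]m+o≡n; n≤1+n; ≤-trans)
open import Data.Nat.Tactic.RingSolver using (solve)
open import Data.Bool using (true; false; T)
open import Data.Bool.Properties using (T-≡)
open import Data.List using (_∷_; [])
open import Data.Product using (_×_; _,_; ∃-syntax)
open import Data.Unit using (tt)
open import Function using (_∘_; Equivalence)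
open import Relation.Nullary using (yes; no; contradiction)
open import Relation.Binary.PropositionalEquality
  using (_≡_; refl; sym; trans; cong; subst; module ≡-Reasoning)
open ≡-Reasoning

InRange : ℕ → ℕ → Set
InRange N x = 1 ≤ x × x ≤ N

iter-inRange : ∀ {N} {σ : ℕ → ℕ} → (∀ x → InRange N x → InRange N (σ x)) →
  ∀ k x → InRange N x → InRange N (iter σ k x)
iter-inRange σ-range zero    x x∈ = x∈
iter-inRange σ-range (suc k) x x∈ = σ-range _ (iter-inRange σ-range k x x∈)

iter-suc : ∀ (f : ℕ → ℕ) k x → iter f (suc k) x ≡ iter f k (f x)
iter-suc f zero    x = refl
iter-suc f (suc k) x = cong f (iter-suc f k x)

iter-conjugate : ∀ {N} {σ τ r : ℕ → ℕ} →
  (∀ x → InRange N x → InRange N (σ x)) →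
  (∀ x → InRange N x → τ (r (σ x)) ≡ r x) →
  ∀ k x → InRange N x → iter τ k (r (iter σ k x)) ≡ r x
iter-conjugate σ-range undo zero    x x∈ = refl
iter-conjugate {σ = σ} {τ} {r} σ-range undo (suc k) x x∈ = begin
  iter τ (suc k) (r (σ (iter σ k x)))  ≡⟨ iter-suc τ k _ ⟩
  iter τ k (τ (r (σ (iter σ k x))))    ≡⟨ cong (iter τ k) (undo _ (iter-inRange σ-range k x x∈)) ⟩
  iter τ k (r (iter σ k x))            ≡⟨ iter-conjugate σ-range undo k x x∈ ⟩
  r x                                  ∎

-- The transfer principle: to reach j from i under τ, run σ from r j to r i.
cyclic-transfer : ∀ {N} {σ τ r : ℕ → ℕ} →
  (∀ x → InRange N x → InRange N (σ x)) →
  (∀ x → InRange N x → InRange N (r x)) →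
  (∀ x → InRange N x → r (r x) ≡ x) →
  (∀ x → InRange N x → τ (r (σ x)) ≡ r x) →
  IsCyclic N σ → IsCyclic N τ
cyclic-transfer {σ = σ} {τ} {r} σ-range r-range r-invol undo cyc i j 1≤i i≤N 1≤j j≤N
  with r-range i (1≤i , i≤N) | r-range j (1≤j , j≤N)
... | 1≤ri , ri≤N | 1≤rj , rj≤N with cyc (r j) (r i) 1≤rj rj≤N 1≤ri ri≤N
... | k , σᵏrj≡ri = k , (begin
  iter τ k i                     ≡⟨ cong (iter τ k) (sym (r-invol i (1≤i , i≤N))) ⟩
  iter τ k (r (r i))             ≡⟨ cong (iter τ k ∘ r) (sym σᵏrj≡ri) ⟩
  iter τ k (r (iter σ k (r j)))  ≡⟨ iter-conjugate σ-range undo k (r j) (1≤rj , rj≤N) ⟩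
  r (r j)                        ≡⟨ r-invol j (1≤j , j≤N) ⟩
  j                              ∎)

reverse : ℕ → ℕ → ℕ
reverse N x = suc N ∸ x

reverse-complement : ∀ N x y → x + y ≡ suc N → reverse N x ≡ y
reverse-complement _ x y x+y≡1+N = subst (λ m → m ∸ x ≡ y) x+y≡1+N (m+n∸m≡n x y)

summand-inRange : ∀ N k m → suc k + m ≡ N → InRange N (suc k)
summand-inRange _ k m refl = s≤s z≤n , m≤m+n (suc k) m

-- r maps [N] into itself: writing N = (t+1) + s, it sends t+1 to s+1.
reverse-inRange : ∀ N x → InRange N x → InRange N (reverse N x)
reverse-inRange N (suc t) (_ , t<N) with m≤n⇒∃[o]m+o≡n t<N
... | s , refl = subst (InRange N) (sym reverse≡) (summand-inRange N s t sum≡)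
  where
  sum≡ : suc s + t ≡ suc t + s
  sum≡ = solve (t ∷ s ∷ [])
  reverse≡ : reverse N (suc t) ≡ suc s
  reverse≡ = reverse-complement N (suc t) (suc s) (solve (t ∷ s ∷ []))

reverse-involutive : ∀ N x → InRange N x → reverse N (reverse N x) ≡ x
reverse-involutive N x (_ , x≤N) = m∸[m∸n]≡n (≤-trans x≤N (n≤1+n N))

≤ᵇ-true : ∀ {m n} → m ≤ n → (m ≤ᵇ n) ≡ true
≤ᵇ-true m≤n = Equivalence.to T-≡ (≤⇒≤ᵇ m≤n)

≤ᵇ-false : ∀ {m n} → n < m → (m ≤ᵇ n) ≡ false
≤ᵇ-false {m} {n} n<m with m ≤ᵇ n in eq
... | false = refl
... | true  = contradiction (≤ᵇ⇒≤ m n (subst T (sym eq) tt)) (<⇒≱ n<m)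

tripPerm-first : ∀ a b c {x} → x ≤ a → tripPerm a b c x ≡ reverse (a + b + c) x
tripPerm-first a b c x≤a rewrite ≤ᵇ-true x≤a = refl

tripPerm-second : ∀ a b c {x} → a < x → x ≤ a + b → tripPerm a b c x ≡ reverse (a + b) x
tripPerm-second a b c a<x x≤a+b rewrite ≤ᵇ-false a<x | ≤ᵇ-true x≤a+b = refl

tripPerm-third : ∀ a b c {x} → a + b < x → tripPerm a b c x ≡ reverse (a + b + c + b) x
tripPerm-third a b c a+b<x
  rewrite ≤ᵇ-false (≤-trans (s≤s (m≤m+n a b)) a+b<x) | ≤ᵇ-false a+b<x = refl

-- Which block a point of [a+b+c] lies in, together with its offset t+1 in the
-- block; the block's length is split as (t+1) + (remaining length).
data Block : ℕ → ℕ → ℕ → ℕ → Set where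
  first  : ∀ t s b c → Block (suc t + s) b c (suc t)
  second : ∀ a t u c → Block a (suc t + u) c (a + suc t)
  third  : ∀ a b t u → Block a b (suc t + u) (a + b + suc t)

beyond : ∀ {m n} → m < n → ∃[ t ] m + suc t ≡ n
beyond {m} m<n with m≤n⇒∃[o]m+o≡n m<n
... | t , m+1+t≡n = t , trans (+-suc m t) m+1+t≡n

block : ∀ a b c x → InRange (a + b + c) x → Block a b c x
block a b c x x∈ with x ≤? a
block a b c (suc t) (s≤s z≤n , _) | yes x≤a with m≤n⇒∃[o]m+o≡n x≤a
... | s , refl = first t s b c
block a b c x (_ , x≤N) | no x≰a with x ≤? a + b
... | yes x≤a+b with beyond (≰⇒> x≰a)
...   | t , refl with m≤n⇒∃[o]m+o≡n (+-cancelˡ-≤ a _ _ x≤a+b)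
...     | u , refl = second a t u c
block a b c x (_ , x≤N) | no x≰a | no x≰a+b with beyond (≰⇒> x≰a+b)
... | t , refl with m≤n⇒∃[o]m+o≡n (+-cancelˡ-≤ (a + b) _ _ x≤N)
...   | u , refl = third a b t u

perm-first : ∀ t s b c → tripPerm (suc t + s) b c (suc t) ≡ suc (s + b + c)
perm-first t s b c = begin
  tripPerm (suc t + s) b c (suc t)
    ≡⟨ tripPerm-first (suc t + s) b c (m≤m+n (suc t) s) ⟩
  reverse (suc t + s + b + c) (suc t)
    ≡⟨ reverse-complement (suc t + s + b + c) (suc t) (suc (s + b + c)) (solve (t ∷ s ∷ b ∷ c ∷ [])) ⟩
  suc (s + b + c) ∎

perm-second : ∀ a t u c → tripPerm a (suc t + u) c (a + suc t) ≡ suc u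
perm-second a t u c = begin
  tripPerm a (suc t + u) c (a + suc t)
    ≡⟨ tripPerm-second a (suc t + u) c (m<m+n a (s≤s z≤n)) (+-monoʳ-≤ a (m≤m+n (suc t) u)) ⟩
  reverse (a + (suc t + u)) (a + suc t)
    ≡⟨ reverse-complement (a + (suc t + u)) (a + suc t) (suc u) (solve (a ∷ t ∷ u ∷ [])) ⟩
  suc u ∎

perm-third : ∀ a b t u → tripPerm a b (suc t + u) (a + b + suc t) ≡ suc (u + b)
perm-third a b t u = begin
  tripPerm a b (suc t + u) (a + b + suc t)
    ≡⟨ tripPerm-third a b (suc t + u) (m<m+n (a + b) (s≤s z≤n)) ⟩
  reverse (a + b + (suc t + u) + b) (a + b + suc t)
    ≡⟨ reverse-complement (a + b + (suc t + u) + b) (a + b + suc t) (suc (u + b)) (solve (a ∷ b ∷ t ∷ u ∷ [])) ⟩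
  suc (u + b) ∎

tripPerm-inRange : ∀ a b c x → InRange (a + b + c) x → InRange (a + b + c) (tripPerm a b c x)
tripPerm-inRange a b c x x∈ with block a b c x x∈
... | first t s _ _  = subst (InRange _) (sym (perm-first t s b c))
  (summand-inRange (suc t + s + b + c) (s + b + c) t (solve (t ∷ s ∷ b ∷ c ∷ [])))
... | second _ t u _ = subst (InRange _) (sym (perm-second a t u c))
  (summand-inRange (a + (suc t + u) + c) u (a + t + c) (solve (a ∷ t ∷ u ∷ c ∷ [])))
... | third _ _ t u  = subst (InRange _) (sym (perm-third a b t u))
  (summand-inRange (a + b + (suc t + u)) (u + b) (a + t) (solve (a ∷ b ∷ t ∷ u ∷ [])))

-- The identity (★)  p_{acb} ∘ r ∘ p_{abc} = r,  block by block: r ∘ p_{abc}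
-- maps the first block of (a,b,c) onto the first block of (a,c,b), the second
-- onto the third and the third onto the second, where p_{acb} lands on r x.
swap-first : ∀ t s b c →
  tripPerm (suc t + s) c b (reverse (suc t + s + b + c) (tripPerm (suc t + s) b c (suc t)))
    ≡ reverse (suc t + s + b + c) (suc t)
swap-first t s b c = begin
  tripPerm (suc t + s) c b (reverse (suc t + s + b + c) (tripPerm (suc t + s) b c (suc t)))
    ≡⟨ cong (tripPerm (suc t + s) c b ∘ reverse (suc t + s + b + c)) (perm-first t s b c) ⟩
  tripPerm (suc t + s) c b (reverse (suc t + s + b + c) (suc (s + b + c)))
    ≡⟨ cong (tripPerm (suc t + s) c b)
         (reverse-complement (suc t + s + b + c) (suc (s + b + c)) (suc t) (solve (t ∷ s ∷ b ∷ c ∷ []))) ⟩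
  tripPerm (suc t + s) c b (suc t)
    ≡⟨ perm-first t s c b ⟩
  suc (s + c + b)
    ≡⟨ reverse-complement (suc t + s + b + c) (suc t) (suc (s + c + b)) (solve (t ∷ s ∷ b ∷ c ∷ [])) ⟨
  reverse (suc t + s + b + c) (suc t) ∎

swap-second : ∀ a t u c →
  tripPerm a c (suc t + u) (reverse (a + (suc t + u) + c) (tripPerm a (suc t + u) c (a + suc t)))
    ≡ reverse (a + (suc t + u) + c) (a + suc t)
swap-second a t u c = begin
  tripPerm a c (suc t + u) (reverse (a + (suc t + u) + c) (tripPerm a (suc t + u) c (a + suc t)))
    ≡⟨ cong (tripPerm a c (suc t + u) ∘ reverse (a + (suc t + u) + c)) (perm-second a t u c) ⟩
  tripPerm a c (suc t + u) (reverse (a + (suc t + u) + c) (suc u))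
    ≡⟨ cong (tripPerm a c (suc t + u))
         (reverse-complement (a + (suc t + u) + c) (suc u) (a + c + suc t) (solve (a ∷ t ∷ u ∷ c ∷ []))) ⟩
  tripPerm a c (suc t + u) (a + c + suc t)
    ≡⟨ perm-third a c t u ⟩
  suc (u + c)
    ≡⟨ reverse-complement (a + (suc t + u) + c) (a + suc t) (suc (u + c)) (solve (a ∷ t ∷ u ∷ c ∷ [])) ⟨
  reverse (a + (suc t + u) + c) (a + suc t) ∎

swap-third : ∀ a b t u →
  tripPerm a (suc t + u) b (reverse (a + b + (suc t + u)) (tripPerm a b (suc t + u) (a + b + suc t)))
    ≡ reverse (a + b + (suc t + u)) (a + b + suc t)
swap-third a b t u = begin
  tripPerm a (suc t + u) b (reverse (a + b + (suc t + u)) (tripPerm a b (suc t + u) (a + b + suc t)))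
    ≡⟨ cong (tripPerm a (suc t + u) b ∘ reverse (a + b + (suc t + u))) (perm-third a b t u) ⟩
  tripPerm a (suc t + u) b (reverse (a + b + (suc t + u)) (suc (u + b)))
    ≡⟨ cong (tripPerm a (suc t + u) b)
         (reverse-complement (a + b + (suc t + u)) (suc (u + b)) (a + suc t) (solve (a ∷ b ∷ t ∷ u ∷ []))) ⟩
  tripPerm a (suc t + u) b (a + suc t)
    ≡⟨ perm-second a t u b ⟩
  suc u
    ≡⟨ reverse-complement (a + b + (suc t + u)) (a + b + suc t) (suc u) (solve (a ∷ b ∷ t ∷ u ∷ [])) ⟨
  reverse (a + b + (suc t + u)) (a + b + suc t) ∎

reverse-swap : ∀ a b c x → InRange (a + b + c) x →
  tripPerm a c b (reverse (a + b + c) (tripPerm a b c x)) ≡ reverse (a + b + c) x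
reverse-swap a b c x x∈ with block a b c x x∈
... | first t s _ _  = swap-first t s b c
... | second _ t u _ = swap-second a t u c
... | third _ _ t u  = swap-third a b t u

good-swap : ∀ a b c → Good a b c → Good a c b
good-swap a b c good = subst (λ n → IsCyclic n (tripPerm a c b)) sum-swap
  (cyclic-transfer (tripPerm-inRange a b c) (reverse-inRange (a + b + c))
                   (reverse-involutive (a + b + c)) (reverse-swap a b c) good)
  where
  sum-swap : a + b + c ≡ a + c + b
  sum-swap = solve (a ∷ b ∷ c ∷ [])

proposition2 : (a b c : ℕ) → 1 ≤ a → 1 ≤ b → 1 ≤ c →
    (Good a b c → Good a c b) × (Good a c b → Good a b c)
proposition2 a b c _ _ _ = good-swap a b c , good-swap a c b
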